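{- Let $L\geq 1$ be an integer and define \[ G_{L,1}(q)=\frac{q}{(q;q)_{L+1}}-\sum_{n\geq 1}\frac{q^{2n}}{1-q^n}{L+n-1\brack n-1}_q, \qquad H_{L,1}(q)=\frac{q}{(q;q)_{L-1}(1-q^{L+1})}-\left(\frac{1}{(q^2;q)_L}-1\right). \] Equivalently, $G_{L,1}(q)$ is the generating function of partitions $\pi$ with positive norm, smallest part $s(\pi)=1$ and $l(\pi)-s(\pi)\le L$, minus the generating function of partitions with positive norm, $s(\pi)\geq 2$ and $l(\pi)-s(\pi)\le L$. Then \[ G_{L,1}(q)=\frac{H_{L,1}(q)}{1-q^L}, \] and $G_{L,1}(q)$ has all coefficients non-negative as a power series in $q$.
   Context: $(a;q)_n=\prod_{i=0}^{n-1}(1-aq^i)$ and ${m\brack k}_q=\frac{(q;q)_m}{(q;q)_k(q;q)_{m-k}}$ is the $q$-binomial coefficient. $s(\pi)$, $l(\pi)$ are the smallest and largest parts of $\pi$. -}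

module Defs where

open import Data.Nat as ℕ using (ℕ; zero; suc; _∸_)
open import Data.Nat.Divisibility using (_∣?_)
open import Data.Integer using (ℤ; 0ℤ; 1ℤ; _+_; _*_; _-_)
open import Relation.Nullary.Decidable using (does)
open import Data.Bool using (if_then_else_)

-- Formal power series in q with integer coefficients: n ↦ coefficient of q^n.
PS : Set
PS = ℕ → ℤ

sumBelow : ℕ → (ℕ → ℤ) → ℤ
sumBelow zero    h = 0ℤ
sumBelow (suc n) h = sumBelow n h + h n

infixl 6 _⊕_ _⊖_
infixl 7 _⊛_

_⊕_ : PS → PS → PS
(f ⊕ g) n = f n + g n

_⊖_ : PS → PS → PS
(f ⊖ g) n = f n - g n

_⊛_ : PS → PS → PS
(f ⊛ g) n = sumBelow (suc n) (λ k → f k * g (n ∸ k))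

one : PS
one zero    = 1ℤ
one (suc _) = 0ℤ

qpow : ℕ → PS
qpow k n = if does (k ℕ.≟ n) then 1ℤ else 0ℤ

oneMinusQ : ℕ → PS
oneMinusQ i = one ⊖ qpow i

-- 1/(1 - q^i) as a geometric series (used only for i ≥ 1):
-- coefficient of q^n is 1 if i divides n, else 0.
geom : ℕ → PS
geom i n = if does (i ∣? n) then 1ℤ else 0ℤ

prodBelow : ℕ → (ℕ → PS) → PS
prodBelow zero    f = one
prodBelow (suc m) f = prodBelow m f ⊛ f m

poch : ℕ → ℕ → PS
poch e m = prodBelow m (λ i → oneMinusQ (e ℕ.+ i))

-- 1/(q^e; q)_m = ∏_{i<m} 1/(1 - q^{e+i})   (used only for e ≥ 1)
invPoch : ℕ → ℕ → PS
invPoch e m = prodBelow m (λ i → geom (e ℕ.+ i))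

qbinom : ℕ → ℕ → PS
qbinom m k = poch 1 m ⊛ invPoch 1 k ⊛ invPoch 1 (m ∸ k)

Gterm : ℕ → ℕ → PS
Gterm L n = qpow (2 ℕ.* n) ⊛ geom n ⊛ qbinom (L ℕ.+ n ∸ 1) (n ∸ 1)

-- G_{L,1}(q) = q/(q;q)_{L+1} - Σ_{n≥1} Gterm L n.
-- The infinite sum is locally finite: Gterm L n = O(q^{2n}), so for the
-- coefficient of q^N only the terms 1 ≤ n ≤ N contribute.
G : ℕ → PS
G L N = (qpow 1 ⊛ invPoch 1 (suc L)) N
        - sumBelow N (λ j → Gterm L (suc j) N)

H : ℕ → PS
H L = qpow 1 ⊛ invPoch 1 (L ∸ 1) ⊛ geom (suc L) ⊖ (invPoch 2 L ⊖ one)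

module Submission where

-- By the
-- q-binomial theorem the sum defining G is a double sum whose columns are
-- q^k/(q^k; q)_{L+1} for k ≥ 2 (Gsum-as-smallestParts), so G is
-- "smallest part 1" minus "smallest part ≥ 2" (G-as-difference).  Each
-- q^k/(q^k; q)_{L+1} times (1 - q^L) telescopes in k, and summing gives
-- (1 - q^L) G = H (G-identity).
-- Non-negativity: H/(1 - q^L) = q/(1 - q^2) for L = 1, while for L ≥ 2 the
-- numerator H splits as (T C - (C - 1)) + C (R - T) with C a product of
-- factors 1/(1 - q^t), and both parts are non-negative (module LargeL).

open import Defs
open import Data.Nat using (ℕ; _≤_)
open import Data.Integer using (0ℤ) renaming (_≤_ to _≤ℤ_)
open import Data.Product using (_×_)
open import Relation.Binary.PropositionalEquality using (_≡_)

open import Data.Nat as ℕ using (zero; suc; _∸_; _<_; z≤n; s≤s)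
import Data.Nat.Properties as ℕP
open import Data.Nat.Divisibility as Div using (_∣_; _∣?_)
import Data.Nat.Tactic.RingSolver as ℕ-Solver
open import Data.Integer as ℤ using (ℤ; 1ℤ; _+_; _*_; _-_; -_)
import Data.Integer.Properties as ℤP
import Data.Integer.Tactic.RingSolver as ℤ-Solver
open import Data.Bool using (if_then_else_)
open import Data.Empty using (⊥-elim)
open import Data.Maybe using (Maybe; just; nothing)
open import Data.Product using (_,_; proj₁; proj₂)
open import Data.Sum using (_⊎_; inj₁; inj₂)
open import Function using (_∘_)
open import Level using (0ℓ)
open import Relation.Nullary using (¬_; Dec; yes; no)
open import Relation.Nullary.Decidable using (does)
open import Relation.Binary.PropositionalEquality
open import Relation.Binary.Structures using (IsEquivalence)
open import Relation.Binary.Bundles using (Setoid)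
import Relation.Binary.Reasoning.Setoid as SetoidReasoning
open import Algebra.Structures using (IsCommutativeRing)
open import Algebra.Bundles using (CommutativeRing)
open import Algebra.Solver.Ring.AlmostCommutativeRing
  using (fromCommutativeRing; _-Raw-AlmostCommutative⟶_)
import Algebra.Solver.Ring

sum-cong-< : ∀ n {f g : ℕ → ℤ} → (∀ k → k < n → f k ≡ g k) → sumBelow n f ≡ sumBelow n g
sum-cong-< zero    eq = refl
sum-cong-< (suc n) eq = cong₂ _+_ (sum-cong-< n (λ k k<n → eq k (ℕP.m<n⇒m<1+n k<n))) (eq n ℕP.≤-refl)

sum-cong : ∀ n {f g : ℕ → ℤ} → (∀ k → f k ≡ g k) → sumBelow n f ≡ sumBelow n g
sum-cong n eq = sum-cong-< n (λ k _ → eq k)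

sum-zero : ∀ n {f : ℕ → ℤ} → (∀ k → k < n → f k ≡ 0ℤ) → sumBelow n f ≡ 0ℤ
sum-zero zero    z = refl
sum-zero (suc n) z = cong₂ _+_ (sum-zero n (λ k k<n → z k (ℕP.m<n⇒m<1+n k<n))) (z n ℕP.≤-refl)

sum-+ : ∀ n (f g : ℕ → ℤ) → sumBelow n (λ k → f k + g k) ≡ sumBelow n f + sumBelow n g
sum-+ zero    f g = refl
sum-+ (suc n) f g = trans (cong (_+ (f n + g n)) (sum-+ n f g)) (interchange (sumBelow n f) (sumBelow n g) (f n) (g n))
  where
    interchange : ∀ a b c d → (a + b) + (c + d) ≡ (a + c) + (b + d)
    interchange = ℤ-Solver.solve-∀

sum-*ˡ : ∀ n c (f : ℕ → ℤ) → sumBelow n (λ k → c * f k) ≡ c * sumBelow n f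
sum-*ˡ zero    c f = sym (ℤP.*-zeroʳ c)
sum-*ˡ (suc n) c f = trans (cong (_+ c * f n) (sum-*ˡ n c f)) (sym (ℤP.*-distribˡ-+ c (sumBelow n f) (f n)))

sum-*ʳ : ∀ n c (f : ℕ → ℤ) → sumBelow n (λ k → f k * c) ≡ sumBelow n f * c
sum-*ʳ zero    c f = refl
sum-*ʳ (suc n) c f = trans (cong (_+ f n * c) (sum-*ʳ n c f)) (sym (ℤP.*-distribʳ-+ c (sumBelow n f) (f n)))

sum-peel : ∀ n (f : ℕ → ℤ) → sumBelow (suc n) f ≡ f 0 + sumBelow n (f ∘ suc)
sum-peel zero    f = ℤP.+-comm 0ℤ (f 0)
sum-peel (suc n) f = trans (cong (_+ f (suc n)) (sum-peel n f)) (ℤP.+-assoc (f 0) (sumBelow n (f ∘ suc)) (f (suc n)))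

sum-reverse : ∀ n (f : ℕ → ℤ) → sumBelow (suc n) f ≡ sumBelow (suc n) (λ k → f (n ∸ k))
sum-reverse zero    f = refl
sum-reverse (suc n) f = begin
    sumBelow (suc n) f + f (suc n)
  ≡⟨ cong (_+ f (suc n)) (sum-reverse n f) ⟩
    sumBelow (suc n) (λ k → f (n ∸ k)) + f (suc n)
  ≡⟨ ℤP.+-comm _ (f (suc n)) ⟩
    f (suc n) + sumBelow (suc n) (λ k → f (n ∸ k))
  ≡⟨ sym (sum-peel (suc n) (λ k → f (suc n ∸ k))) ⟩
    sumBelow (suc (suc n)) (λ k → f (suc n ∸ k)) ∎
  where open ≡-Reasoning

sum-swap : ∀ n m (F : ℕ → ℕ → ℤ) →
  sumBelow n (λ i → sumBelow m (F i)) ≡ sumBelow m (λ j → sumBelow n (λ i → F i j))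
sum-swap zero    m F = sym (sum-zero m (λ _ _ → refl))
sum-swap (suc n) m F = trans (cong (_+ sumBelow m (F n)) (sum-swap n m F)) (sym (sum-+ m _ (F n)))

sum-telescope : ∀ n (b : ℕ → ℤ) → sumBelow n (λ j → b j - b (suc j)) ≡ b 0 - b n
sum-telescope zero    b = sym (ℤP.+-inverseʳ (b 0))
sum-telescope (suc n) b = trans (cong (_+ (b n - b (suc n))) (sum-telescope n b)) (collapse (b 0) (b n) (b (suc n)))
  where
    collapse : ∀ x y z → (x - y) + (y - z) ≡ x - z
    collapse = ℤ-Solver.solve-∀

sum-pad : ∀ n m (f : ℕ → ℤ) → n ≤ m → (∀ k → n ≤ k → k < m → f k ≡ 0ℤ) →
  sumBelow m f ≡ sumBelow n f
sum-pad n zero    f z≤n vanish = refl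
sum-pad n (suc m) f n≤1+m vanish with n ℕ.≟ suc m
... | yes refl = refl
... | no  n≢1+m = trans (cong₂ _+_ (sum-pad n m f n≤m (λ k n≤k k<m → vanish k n≤k (ℕP.m<n⇒m<1+n k<m)))
                                    (vanish m n≤m ℕP.≤-refl))
                         (ℤP.+-identityʳ (sumBelow n f))
  where n≤m = ℕP.≤-pred (ℕP.≤∧≢⇒< n≤1+m n≢1+m)

-- Interchanging the order of a triangular double sum over  i + j ≤ n:
-- both sides equal the square sum of the summands cut off by  [i + j ≤ n].
sum-triangle : ∀ n (F : ℕ → ℕ → ℤ) →
  sumBelow (suc n) (λ i → sumBelow (suc (n ∸ i)) (F i)) ≡
  sumBelow (suc n) (λ j → sumBelow (suc (n ∸ j)) (λ i → F i j))
sum-triangle n F = begin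
    sumBelow (suc n) (λ i → sumBelow (suc (n ∸ i)) (F i))
  ≡⟨ sum-cong-< (suc n) (λ i i≤n → row i (F i) (ℕP.≤-pred i≤n)) ⟩
    sumBelow (suc n) (λ i → sumBelow (suc n) (λ j → cut (i ℕ.+ j) (F i j)))
  ≡⟨ sum-swap (suc n) (suc n) _ ⟩
    sumBelow (suc n) (λ j → sumBelow (suc n) (λ i → cut (i ℕ.+ j) (F i j)))
  ≡⟨ sum-cong (suc n) (λ j → sum-cong (suc n) (λ i → cong (λ s → cut s (F i j)) (ℕP.+-comm i j))) ⟩
    sumBelow (suc n) (λ j → sumBelow (suc n) (λ i → cut (j ℕ.+ i) (F i j)))
  ≡⟨ sym (sum-cong-< (suc n) (λ j j≤n → row j (λ i → F i j) (ℕP.≤-pred j≤n))) ⟩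
    sumBelow (suc n) (λ j → sumBelow (suc (n ∸ j)) (λ i → F i j)) ∎
  where
    open ≡-Reasoning
    cut : ℕ → ℤ → ℤ
    cut s x with s ℕ.≤? n
    ... | yes _ = x
    ... | no  _ = 0ℤ
    cut-in : ∀ s x → s ≤ n → cut s x ≡ x
    cut-in s x s≤n with s ℕ.≤? n
    ... | yes _   = refl
    ... | no  s≰n = ⊥-elim (s≰n s≤n)
    cut-out : ∀ s x → ¬ s ≤ n → cut s x ≡ 0ℤ
    cut-out s x s≰n with s ℕ.≤? n
    ... | yes s≤n = ⊥-elim (s≰n s≤n)
    ... | no  _   = refl
    row : ∀ i (f : ℕ → ℤ) → i ≤ n → sumBelow (suc (n ∸ i)) f ≡ sumBelow (suc n) (λ j → cut (i ℕ.+ j) (f j))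
    row i f i≤n = sym (trans
      (sum-pad (suc (n ∸ i)) (suc n) _ (s≤s (ℕP.m∸n≤m n i))
         (λ k n-i<k _ → cut-out (i ℕ.+ k) (f k) (λ i+k≤n → ℕP.<⇒≱ n-i<k (below i+k≤n))))
      (sum-cong-< (suc (n ∸ i)) (λ k k≤n-i → cut-in (i ℕ.+ k) (f k) (within k (ℕP.≤-pred k≤n-i)))))
      where
        below : ∀ {k} → i ℕ.+ k ≤ n → k ≤ n ∸ i
        below {k} le = subst (_≤ n ∸ i) (ℕP.m+n∸m≡n i k) (ℕP.∸-monoˡ-≤ i le)
        within : ∀ k → k ≤ n ∸ i → i ℕ.+ k ≤ n
        within k k≤n-i = subst (i ℕ.+ k ≤_) (ℕP.m+[n∸m]≡n i≤n) (ℕP.+-monoʳ-≤ i k≤n-i)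

-- Formal power series form a commutative ring under coefficientwise
-- equality  f ≈ g  (there is no function extensionality, so _≡_ is too fine).

infix 4 _≈_
_≈_ : PS → PS → Set
f ≈ g = ∀ n → f n ≡ g n

≈-refl : ∀ {f} → f ≈ f
≈-refl _ = refl

≈-sym : ∀ {f g} → f ≈ g → g ≈ f
≈-sym f≈g n = sym (f≈g n)

≈-trans : ∀ {f g h} → f ≈ g → g ≈ h → f ≈ h
≈-trans f≈g g≈h n = trans (f≈g n) (g≈h n)

≡⇒≈ : ∀ {f g} → f ≡ g → f ≈ g
≡⇒≈ refl = ≈-refl

≈-isEquivalence : IsEquivalence _≈_
≈-isEquivalence = record { refl = ≈-refl ; sym = ≈-sym ; trans = ≈-trans }

PS-setoid : Setoid 0ℓ 0ℓ
PS-setoid = record { isEquivalence = ≈-isEquivalence }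

zeroPS : PS
zeroPS _ = 0ℤ

⊝_ : PS → PS
(⊝ f) n = - f n

⊕-cong : ∀ {f f′ g g′} → f ≈ f′ → g ≈ g′ → f ⊕ g ≈ f′ ⊕ g′
⊕-cong p q n = cong₂ _+_ (p n) (q n)

⊖-cong : ∀ {f f′ g g′} → f ≈ f′ → g ≈ g′ → f ⊖ g ≈ f′ ⊖ g′
⊖-cong p q n = cong₂ _-_ (p n) (q n)

⊛-cong : ∀ {f f′ g g′} → f ≈ f′ → g ≈ g′ → f ⊛ g ≈ f′ ⊛ g′
⊛-cong p q n = sum-cong (suc n) (λ k → cong₂ _*_ (p k) (q (n ∸ k)))

⊛-congˡ : ∀ {f f′} g → f ≈ f′ → f ⊛ g ≈ f′ ⊛ g
⊛-congˡ g p = ⊛-cong p (≈-refl {g})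

⊛-congʳ : ∀ f {g g′} → g ≈ g′ → f ⊛ g ≈ f ⊛ g′
⊛-congʳ f q = ⊛-cong (≈-refl {f}) q

⊛-comm : ∀ f g → f ⊛ g ≈ g ⊛ f
⊛-comm f g n = trans (sum-reverse n (λ k → f k * g (n ∸ k)))
  (sum-cong-< (suc n) (λ k k≤n → trans (cong (λ i → f (n ∸ k) * g i) (ℕP.m∸[m∸n]≡n (ℕP.≤-pred k≤n)))
                                       (ℤP.*-comm (f (n ∸ k)) (g k))))

-- Associativity: both sides are the triangular double sum of
-- f a · h c · g (n - a - c), summed in the two possible orders.
⊛-assoc : ∀ f g h → (f ⊛ g) ⊛ h ≈ f ⊛ (g ⊛ h)
⊛-assoc f g h n = begin
    ((f ⊛ g) ⊛ h) n
  ≡⟨ ⊛-comm (f ⊛ g) h n ⟩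
    sumBelow (suc n) (λ c → h c * sumBelow (suc (n ∸ c)) (λ a → f a * g (n ∸ c ∸ a)))
  ≡⟨ sum-cong (suc n) (λ c → sym (sum-*ˡ (suc (n ∸ c)) (h c) _)) ⟩
    sumBelow (suc n) (λ c → sumBelow (suc (n ∸ c)) (λ a → h c * (f a * g (n ∸ c ∸ a))))
  ≡⟨ sum-triangle n _ ⟩
    sumBelow (suc n) (λ a → sumBelow (suc (n ∸ a)) (λ c → h c * (f a * g (n ∸ c ∸ a))))
  ≡⟨ sum-cong (suc n) (λ a → sum-cong (suc (n ∸ a)) (λ c → regroup a c)) ⟩
    sumBelow (suc n) (λ a → sumBelow (suc (n ∸ a)) (λ c → f a * (h c * g (n ∸ a ∸ c))))
  ≡⟨ sum-cong (suc n) (λ a → sum-*ˡ (suc (n ∸ a)) (f a) _) ⟩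
    (f ⊛ (h ⊛ g)) n
  ≡⟨ ⊛-congʳ f (⊛-comm h g) n ⟩
    (f ⊛ (g ⊛ h)) n ∎
  where
    open ≡-Reasoning
    swap-∸ : ∀ a c → n ∸ c ∸ a ≡ n ∸ a ∸ c
    swap-∸ a c = trans (ℕP.∸-+-assoc n c a) (trans (cong (n ∸_) (ℕP.+-comm c a)) (sym (ℕP.∸-+-assoc n a c)))
    commute : ∀ x y z → x * (y * z) ≡ y * (x * z)
    commute = ℤ-Solver.solve-∀
    regroup : ∀ a c → h c * (f a * g (n ∸ c ∸ a)) ≡ f a * (h c * g (n ∸ a ∸ c))
    regroup a c = trans (cong (λ i → h c * (f a * g i)) (swap-∸ a c)) (commute (h c) (f a) (g (n ∸ a ∸ c)))

⊛-distribˡ : ∀ f g h → f ⊛ (g ⊕ h) ≈ f ⊛ g ⊕ f ⊛ h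
⊛-distribˡ f g h n = trans (sum-cong (suc n) (λ k → ℤP.*-distribˡ-+ (f k) (g (n ∸ k)) (h (n ∸ k))))
                           (sum-+ (suc n) _ _)

⊛-distribʳ : ∀ f g h → (g ⊕ h) ⊛ f ≈ g ⊛ f ⊕ h ⊛ f
⊛-distribʳ f g h = ≈-trans (⊛-comm (g ⊕ h) f) (≈-trans (⊛-distribˡ f g h) (⊕-cong (⊛-comm f g) (⊛-comm f h)))

⊛-identityˡ : ∀ f → one ⊛ f ≈ f
⊛-identityˡ f n = trans (sum-peel n (λ k → one k * f (n ∸ k)))
  (trans (cong₂ _+_ (ℤP.*-identityˡ (f n)) (sum-zero n (λ k _ → ℤP.*-zeroˡ (f (n ∸ suc k)))))
         (ℤP.+-identityʳ (f n)))

⊛-identityʳ : ∀ f → f ⊛ one ≈ f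
⊛-identityʳ f = ≈-trans (⊛-comm f one) (⊛-identityˡ f)

PS-isCommutativeRing : IsCommutativeRing _≈_ _⊕_ _⊛_ ⊝_ zeroPS one
PS-isCommutativeRing = record
  { isRing = record
    { +-isAbelianGroup = record
      { isGroup = record
        { isMonoid = record
          { isSemigroup = record
            { isMagma = record { isEquivalence = ≈-isEquivalence ; ∙-cong = ⊕-cong }
            ; assoc = λ f g h n → ℤP.+-assoc (f n) (g n) (h n) }
          ; identity = (λ f n → ℤP.+-identityˡ (f n)) , (λ f n → ℤP.+-identityʳ (f n)) }
        ; inverse = (λ f n → ℤP.+-inverseˡ (f n)) , (λ f n → ℤP.+-inverseʳ (f n))
        ; ⁻¹-cong = λ p n → cong -_ (p n) }
      ; comm = λ f g n → ℤP.+-comm (f n) (g n) }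
    ; *-cong = ⊛-cong
    ; *-assoc = ⊛-assoc
    ; *-identity = ⊛-identityˡ , ⊛-identityʳ
    ; distrib = ⊛-distribˡ , ⊛-distribʳ }
  ; *-comm = ⊛-comm }

PS-commutativeRing : CommutativeRing 0ℓ 0ℓ
PS-commutativeRing = record { isCommutativeRing = PS-isCommutativeRing }

-- Integer constants as series.  The constant 1 is sent to `one` itself, so
-- that solver expressions containing `con 1ℤ` match goals containing `one`.
constant : ℤ → PS
constant c zero    = c
constant c (suc _) = 0ℤ

embed : ℤ → PS
embed (ℤ.+ 1) = one
embed c       = constant c

embed≈constant : ∀ c → embed c ≈ constant c
embed≈constant (ℤ.+ 0)           _       = refl
embed≈constant (ℤ.+ 1)           zero    = refl
embed≈constant (ℤ.+ 1)           (suc _) = refl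
embed≈constant (ℤ.+ suc (suc _)) _       = refl
embed≈constant ℤ.-[1+ _ ]        _       = refl

constant-* : ∀ a b → constant (a * b) ≈ constant a ⊛ constant b
constant-* a b zero    = sym (ℤP.+-identityˡ (a * b))
constant-* a b (suc m) = sym (sum-zero (suc (suc m)) vanish)
  where
    vanish : ∀ k → k < suc (suc m) → constant a k * constant b (suc m ∸ k) ≡ 0ℤ
    vanish zero    _ = ℤP.*-zeroʳ a
    vanish (suc k) _ = refl

embed-hom : CommutativeRing.rawRing ℤP.+-*-commutativeRing
            -Raw-AlmostCommutative⟶ fromCommutativeRing PS-commutativeRing
embed-hom = record
  { ⟦_⟧    = embed
  ; +-homo = λ a b → via (a + b) (λ { zero → refl ; (suc _) → refl }) (⊕-cong (embed≈constant a) (embed≈constant b))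
  ; *-homo = λ a b → via (a * b) (constant-* a b) (⊛-cong (embed≈constant a) (embed≈constant b))
  ; -‿homo = λ a → via (- a) (λ { zero → refl ; (suc _) → refl }) (λ n → cong -_ (embed≈constant a n))
  ; 0-homo = λ { zero → refl ; (suc _) → refl }
  ; 1-homo = λ _ → refl }
  where
    via : ∀ c {g g′} → constant c ≈ g′ → g ≈ g′ → embed c ≈ g
    via c p q = ≈-trans (embed≈constant c) (≈-trans p (≈-sym q))

embed-≟ : ∀ a b → Maybe (embed a ≈ embed b)
embed-≟ a b with a ℤ.≟ b
... | yes refl = just ≈-refl
... | no  _    = nothing

module PS-Solver = Algebra.Solver.Ring (CommutativeRing.rawRing ℤP.+-*-commutativeRing)
  (fromCommutativeRing PS-commutativeRing) embed-hom embed-≟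

open PS-Solver using (solve; _:=_; _:+_; _:*_; _:-_; con)

decide-yes : ∀ {P : Set} (d : Dec P) → P → (if does d then 1ℤ else 0ℤ) ≡ 1ℤ
decide-yes (yes _) _ = refl
decide-yes (no ¬p) p = ⊥-elim (¬p p)

decide-no : ∀ {P : Set} (d : Dec P) → ¬ P → (if does d then 1ℤ else 0ℤ) ≡ 0ℤ
decide-no (yes p) ¬p = ⊥-elim (¬p p)
decide-no (no _)  _  = refl

qpow-shift : ∀ k f n → k ≤ n → (qpow k ⊛ f) n ≡ f (n ∸ k)
qpow-shift k f n k≤n = pick (suc n) (s≤s k≤n)
  where
    miss : ∀ m → m ≤ k → sumBelow m (λ j → qpow k j * f (n ∸ j)) ≡ 0ℤ
    miss m m≤k = sum-zero m (λ j j<m → trans (cong (_* f (n ∸ j)) (decide-no (k ℕ.≟ j)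
                   (λ k≡j → ℕP.<⇒≱ j<m (subst (m ≤_) k≡j m≤k)))) (ℤP.*-zeroˡ (f (n ∸ j))))
    pick : ∀ m → k < m → sumBelow m (λ j → qpow k j * f (n ∸ j)) ≡ f (n ∸ k)
    pick (suc m) k<1+m with k ℕ.≟ m
    ... | yes refl = trans (cong₂ _+_ (miss k ℕP.≤-refl) (cong (_* f (n ∸ k)) (decide-yes (k ℕ.≟ k) refl)))
                           (trans (ℤP.+-identityˡ _) (ℤP.*-identityˡ _))
    ... | no  k≢m  = trans (cong₂ _+_ (pick m (ℕP.≤∧≢⇒< (ℕP.≤-pred k<1+m) k≢m)) (cong (_* f (n ∸ m)) (decide-no (k ℕ.≟ m) k≢m)))
                           (ℤP.+-identityʳ _)

qpow-below : ∀ k f n → n < k → (qpow k ⊛ f) n ≡ 0ℤ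
qpow-below k f n n<k = sum-zero (suc n) (λ j j≤n → trans (cong (_* f (n ∸ j)) (decide-no (k ℕ.≟ j)
  (λ k≡j → ℕP.<⇒≱ n<k (subst (_≤ n) (sym k≡j) (ℕP.≤-pred j≤n))))) (ℤP.*-zeroˡ (f (n ∸ j))))

qpow-+ : ∀ a b → qpow a ⊛ qpow b ≈ qpow (a ℕ.+ b)
qpow-+ a b n with a ℕ.≤? n
... | no  a≰n = trans (qpow-below a (qpow b) n (ℕP.≰⇒> a≰n))
                      (sym (decide-no (a ℕ.+ b ℕ.≟ n) (λ a+b≡n → a≰n (subst (a ≤_) a+b≡n (ℕP.m≤m+n a b)))))
... | yes a≤n = trans (qpow-shift a (qpow b) n a≤n) (compare (a ℕ.+ b ℕ.≟ n))
  where
    compare : Dec (a ℕ.+ b ≡ n) → qpow b (n ∸ a) ≡ qpow (a ℕ.+ b) n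
    compare (yes refl)  = trans (cong (qpow b) (ℕP.m+n∸m≡n a b))
                                (trans (decide-yes (b ℕ.≟ b) refl) (sym (decide-yes (a ℕ.+ b ℕ.≟ a ℕ.+ b) refl)))
    compare (no a+b≢n) = trans (decide-no (b ℕ.≟ n ∸ a) (λ b≡n-a → a+b≢n (trans (cong (a ℕ.+_) b≡n-a) (ℕP.m+[n∸m]≡n a≤n))))
                               (sym (decide-no (a ℕ.+ b ℕ.≟ n) a+b≢n))

qpow-zero : qpow 0 ≈ one
qpow-zero zero    = refl
qpow-zero (suc n) = refl

geom-small : ∀ i n → n < i → geom i n ≡ one n
geom-small i zero    _   = decide-yes (i ∣? 0) (i Div.∣0)
geom-small i (suc n) n<i = decide-no (i ∣? suc n) (λ i∣1+n → ℕP.<⇒≱ n<i (Div.∣⇒≤ i∣1+n))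

geom-periodic : ∀ i n → i ≤ n → geom i n ≡ geom i (n ∸ i)
geom-periodic i n i≤n with i ∣? n | i ∣? (n ∸ i)
... | yes _   | yes _     = refl
... | no  _   | no  _     = refl
... | yes i∣n | no  i∤n-i = ⊥-elim (i∤n-i (Div.∣m+n∣m⇒∣n (subst (i ∣_) (sym (ℕP.m+[n∸m]≡n i≤n)) i∣n) Div.∣-refl))
... | no  i∤n | yes i∣n-i = ⊥-elim (i∤n (Div.∣m∸n∣n⇒∣m i i≤n i∣n-i Div.∣-refl))

geom-inverse : ∀ i → 1 ≤ i → geom i ⊛ oneMinusQ i ≈ one
geom-inverse i 1≤i n = begin
    (geom i ⊛ (one ⊖ qpow i)) n
  ≡⟨ solve 2 (λ g x → g :* (con 1ℤ :- x) := g :- x :* g) ≈-refl (geom i) (qpow i) n ⟩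
    geom i n - (qpow i ⊛ geom i) n
  ≡⟨ by-degree (i ℕ.≤? n) ⟩
    one n ∎
  where
    open ≡-Reasoning
    by-degree : Dec (i ≤ n) → geom i n - (qpow i ⊛ geom i) n ≡ one n
    by-degree (yes i≤n) = trans (cong₂ _-_ (geom-periodic i n i≤n) (qpow-shift i (geom i) n i≤n))
                                (trans (ℤP.+-inverseʳ (geom i (n ∸ i))) (sym (positive n (ℕP.<-≤-trans 1≤i i≤n))))
      where positive : ∀ n → 1 ≤ n → one n ≡ 0ℤ
            positive (suc n) _ = refl
    by-degree (no i≰n) = trans (cong₂ _-_ (geom-small i n (ℕP.≰⇒> i≰n)) (qpow-below i (geom i) n (ℕP.≰⇒> i≰n)))
                               (ℤP.+-identityʳ (one n))

geom-unfold : ∀ i → 1 ≤ i → geom i ≈ one ⊕ qpow i ⊛ geom i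
geom-unfold i 1≤i = begin
    geom i
  ≈⟨ solve 2 (λ g x → g := g :* (con 1ℤ :- x) :+ x :* g) ≈-refl (geom i) (qpow i) ⟩
    geom i ⊛ oneMinusQ i ⊕ qpow i ⊛ geom i
  ≈⟨ ⊕-cong (geom-inverse i 1≤i) (≈-refl {qpow i ⊛ geom i}) ⟩
    one ⊕ qpow i ⊛ geom i ∎
  where open SetoidReasoning PS-setoid

geom-solve : ∀ i → 1 ≤ i → ∀ X Y → X ≈ Y ⊕ qpow i ⊛ X → X ≈ Y ⊛ geom i
geom-solve i 1≤i X Y X≈Y+qX = begin
    X
  ≈⟨ ≈-sym (⊛-identityʳ X) ⟩
    X ⊛ one
  ≈⟨ ⊛-congʳ X (≈-sym (geom-inverse i 1≤i)) ⟩
    X ⊛ (geom i ⊛ (one ⊖ qpow i))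
  ≈⟨ solve 3 (λ x g y → x :* (g :* (con 1ℤ :- y)) := (x :- y :* x) :* g) ≈-refl X (geom i) (qpow i) ⟩
    (X ⊖ qpow i ⊛ X) ⊛ geom i
  ≈⟨ ⊛-congˡ (geom i) (⊖-cong X≈Y+qX (≈-refl {qpow i ⊛ X})) ⟩
    (Y ⊕ qpow i ⊛ X ⊖ qpow i ⊛ X) ⊛ geom i
  ≈⟨ ⊛-congˡ (geom i) (solve 2 (λ y z → y :+ z :- z := y) ≈-refl Y (qpow i ⊛ X)) ⟩
    Y ⊛ geom i ∎
  where open SetoidReasoning PS-setoid

VanishesBelow : ℕ → PS → Set
VanishesBelow a f = ∀ n → n < a → f n ≡ 0ℤ

vanishes-⊛ˡ : ∀ a f g → VanishesBelow a f → VanishesBelow a (f ⊛ g)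
vanishes-⊛ˡ a f g f-vanishes n n<a = sum-zero (suc n) (λ j j≤n →
  trans (cong (_* g (n ∸ j)) (f-vanishes j (ℕP.≤-<-trans (ℕP.≤-pred j≤n) n<a))) (ℤP.*-zeroˡ (g (n ∸ j))))


vanishes-qpow : ∀ a b f → a ≤ b → VanishesBelow a (qpow b ⊛ f)
vanishes-qpow a b f a≤b n n<a = qpow-below b f n (ℕP.<-≤-trans n<a a≤b)

-- Locally finite infinite sums  Σ_m F m : when F m = O(q^m), the
-- coefficient of q^N only involves the terms m ≤ N.

LocallyFinite : (ℕ → PS) → Set
LocallyFinite F = ∀ m → VanishesBelow m (F m)

Σ∞ : (ℕ → PS) → PS
Σ∞ F N = sumBelow (suc N) (λ m → F m N)

Σ∞-cong : ∀ {F F′ : ℕ → PS} → (∀ m → F m ≈ F′ m) → Σ∞ F ≈ Σ∞ F′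
Σ∞-cong F≈F′ N = sum-cong (suc N) (λ m → F≈F′ m N)

Σ∞-⊕ : ∀ F F′ → Σ∞ (λ m → F m ⊕ F′ m) ≈ Σ∞ F ⊕ Σ∞ F′
Σ∞-⊕ F F′ N = sum-+ (suc N) _ _

Σ∞-swap : ∀ (F : ℕ → ℕ → PS) → Σ∞ (λ m → Σ∞ (F m)) ≈ Σ∞ (λ j → Σ∞ (λ m → F m j))
Σ∞-swap F N = sum-swap (suc N) (suc N) (λ m j → F m j N)

Σ∞-peel : ∀ F → LocallyFinite F → Σ∞ F ≈ F 0 ⊕ Σ∞ (F ∘ suc)
Σ∞-peel F finite N = trans (sum-peel N (λ m → F m N))
  (cong (F 0 N +_) (sym (trans (cong (sumBelow N (λ m → F (suc m) N) +_) (finite (suc N) N ℕP.≤-refl))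
                               (ℤP.+-identityʳ _))))

Σ∞-⊛ʳ : ∀ F h → LocallyFinite F → Σ∞ F ⊛ h ≈ Σ∞ (λ m → F m ⊛ h)
Σ∞-⊛ʳ F h finite N = begin
    sumBelow (suc N) (λ i → sumBelow (suc i) (λ m → F m i) * h (N ∸ i))
  ≡⟨ sum-cong-< (suc N) (λ i i≤N → cong (_* h (N ∸ i)) (sym (sum-pad (suc i) (suc N) (λ m → F m i) i≤N
                                                              (λ m i<m _ → finite m i i<m)))) ⟩
    sumBelow (suc N) (λ i → sumBelow (suc N) (λ m → F m i) * h (N ∸ i))
  ≡⟨ sum-cong (suc N) (λ i → sym (sum-*ʳ (suc N) (h (N ∸ i)) (λ m → F m i))) ⟩
    sumBelow (suc N) (λ i → sumBelow (suc N) (λ m → F m i * h (N ∸ i)))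
  ≡⟨ sum-swap (suc N) (suc N) (λ i m → F m i * h (N ∸ i)) ⟩
    Σ∞ (λ m → F m ⊛ h) N ∎
  where open ≡-Reasoning

Σ∞-⊛ˡ : ∀ h F → LocallyFinite F → h ⊛ Σ∞ F ≈ Σ∞ (λ m → h ⊛ F m)
Σ∞-⊛ˡ h F finite = ≈-trans (⊛-comm h (Σ∞ F)) (≈-trans (Σ∞-⊛ʳ F h finite) (Σ∞-cong (λ m → ⊛-comm (F m) h)))

Σ∞-telescope : ∀ (B : ℕ → PS) N → Σ∞ (λ j → B j ⊖ B (suc j)) N ≡ B 0 N - B (suc N) N
Σ∞-telescope B N = sum-telescope (suc N) (λ j → B j N)

≤-multiple : ∀ {i} j → 1 ≤ i → j ≤ i ℕ.* j
≤-multiple {i} j 1≤i = subst (_≤ i ℕ.* j) (ℕP.*-identityˡ j) (ℕP.*-monoˡ-≤ j 1≤i)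

qpow-family-finite : ∀ (e : ℕ → ℕ) → (∀ j → j ≤ e j) → LocallyFinite (qpow ∘ e)
qpow-family-finite e j≤e j n n<j = decide-no (e j ℕ.≟ n)
  (λ e≡n → ℕP.<⇒≱ n<j (subst (j ≤_) e≡n (j≤e j)))

qpow-multiples-finite : ∀ i → 1 ≤ i → LocallyFinite (λ j → qpow (i ℕ.* j))
qpow-multiples-finite i 1≤i = qpow-family-finite (i ℕ.*_) (λ j → ≤-multiple j 1≤i)

geom-as-Σ∞ : ∀ i → 1 ≤ i → Σ∞ (λ j → qpow (i ℕ.* j)) ≈ geom i
geom-as-Σ∞ i 1≤i = ≈-trans (geom-solve i 1≤i S one unfold) (⊛-identityˡ (geom i))
  where
    open SetoidReasoning PS-setoid
    S = Σ∞ (λ j → qpow (i ℕ.* j))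
    unfold : S ≈ one ⊕ qpow i ⊛ S
    unfold = begin
        S
      ≈⟨ Σ∞-peel _ (qpow-multiples-finite i 1≤i) ⟩
        qpow (i ℕ.* 0) ⊕ Σ∞ (λ j → qpow (i ℕ.* suc j))
      ≈⟨ ⊕-cong (≈-trans (≡⇒≈ (cong qpow (ℕP.*-zeroʳ i))) qpow-zero)
                (Σ∞-cong (λ j → ≈-trans (≡⇒≈ (cong qpow (ℕP.*-suc i j))) (≈-sym (qpow-+ i (i ℕ.* j))))) ⟩
        one ⊕ Σ∞ (λ j → qpow i ⊛ qpow (i ℕ.* j))
      ≈⟨ ⊕-cong (≈-refl {one}) (≈-sym (Σ∞-⊛ˡ (qpow i) _ (qpow-multiples-finite i 1≤i))) ⟩
        one ⊕ qpow i ⊛ S ∎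

prod-cong : ∀ m {f g : ℕ → PS} → (∀ i → f i ≈ g i) → prodBelow m f ≈ prodBelow m g
prod-cong zero    f≈g = ≈-refl
prod-cong (suc m) f≈g = ⊛-cong (prod-cong m f≈g) (f≈g m)

prod-peel : ∀ m (f : ℕ → PS) → prodBelow (suc m) f ≈ f 0 ⊛ prodBelow m (f ∘ suc)
prod-peel zero    f = ⊛-comm one (f 0)
prod-peel (suc m) f = ≈-trans (⊛-congˡ (f (suc m)) (prod-peel m f)) (⊛-assoc (f 0) (prodBelow m (f ∘ suc)) (f (suc m)))

poch-inverse : ∀ e m → 1 ≤ e → poch e m ⊛ invPoch e m ≈ one
poch-inverse e zero    _   = ⊛-identityˡ one
poch-inverse e (suc m) 1≤e = begin
    (poch e m ⊛ u) ⊛ (invPoch e m ⊛ g)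
  ≈⟨ solve 4 (λ p u i g → (p :* u) :* (i :* g) := (p :* i) :* (g :* u)) ≈-refl (poch e m) u (invPoch e m) g ⟩
    (poch e m ⊛ invPoch e m) ⊛ (g ⊛ u)
  ≈⟨ ⊛-cong (poch-inverse e m 1≤e) (geom-inverse (e ℕ.+ m) (ℕP.≤-trans 1≤e (ℕP.m≤m+n e m))) ⟩
    one ⊛ one
  ≈⟨ ⊛-identityˡ one ⟩
    one ∎
  where
    open SetoidReasoning PS-setoid
    u = oneMinusQ (e ℕ.+ m)
    g = geom (e ℕ.+ m)

invPoch-peel : ∀ e m → invPoch e (suc m) ≈ geom e ⊛ invPoch (suc e) m
invPoch-peel e m = ≈-trans (prod-peel m (λ i → geom (e ℕ.+ i)))
  (⊛-cong (≡⇒≈ (cong geom (ℕP.+-identityʳ e))) (prod-cong m (λ i → ≡⇒≈ (cong geom (ℕP.+-suc e i)))))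

OneBelow : ℕ → PS → Set
OneBelow e f = ∀ n → n < e → f n ≡ one n

one-below-⊛ : ∀ e f g → OneBelow e f → OneBelow e g → OneBelow e (f ⊛ g)
one-below-⊛ e f g f≡1 g≡1 n n<e = trans
  (sum-cong-< (suc n) (λ j j≤n → cong₂ _*_ (f≡1 j (ℕP.≤-<-trans (ℕP.≤-pred j≤n) n<e))
                                           (g≡1 (n ∸ j) (ℕP.≤-<-trans (ℕP.m∸n≤m n j) n<e))))
  (⊛-identityˡ one n)

invPoch-one-below : ∀ e m → OneBelow e (invPoch e m)
invPoch-one-below e zero    n _ = refl
invPoch-one-below e (suc m) = one-below-⊛ e _ _ (invPoch-one-below e m)
  (λ n n<e → geom-small (e ℕ.+ m) n (ℕP.<-≤-trans n<e (ℕP.m≤m+n e m)))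

gauss : ℕ → ℕ → PS
gauss L m = qbinom (L ℕ.+ m) m

gauss-unfold : ∀ L m → gauss L m ≈ poch 1 (L ℕ.+ m) ⊛ invPoch 1 m ⊛ invPoch 1 L
gauss-unfold L m = ≡⇒≈ (cong (λ l → poch 1 (L ℕ.+ m) ⊛ invPoch 1 m ⊛ invPoch 1 l) (ℕP.m+n∸n≡m L m))

gauss-m0 : ∀ L → gauss L 0 ≈ one
gauss-m0 L = begin
    gauss L 0
  ≈⟨ gauss-unfold L 0 ⟩
    poch 1 (L ℕ.+ 0) ⊛ one ⊛ invPoch 1 L
  ≈⟨ ⊛-congˡ (invPoch 1 L) (⊛-congˡ one (≡⇒≈ (cong (poch 1) (ℕP.+-identityʳ L)))) ⟩
    poch 1 L ⊛ one ⊛ invPoch 1 L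
  ≈⟨ ⊛-congˡ (invPoch 1 L) (⊛-identityʳ (poch 1 L)) ⟩
    poch 1 L ⊛ invPoch 1 L
  ≈⟨ poch-inverse 1 L ℕP.≤-refl ⟩
    one ∎
  where open SetoidReasoning PS-setoid

gauss-0m : ∀ m → gauss 0 m ≈ one
gauss-0m m = ≈-trans (gauss-unfold 0 m) (≈-trans (⊛-identityʳ _) (poch-inverse 1 m ℕP.≤-refl))

-- Write (q;q)_{L+m+2} = (q;q)_{L+m+1} (1 - q^{L+1} q^{m+1}) and split
-- 1 - q^{L+1} q^{m+1} = (1 - q^{L+1}) + q^{L+1} (1 - q^{m+1}); each of the two
-- factors 1 - q^i cancels against the factor 1/(1 - q^i) of the denominator.
gauss-pascal : ∀ L m → gauss (suc L) (suc m) ≈ gauss L (suc m) ⊕ qpow (suc L) ⊛ gauss (suc L) m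
gauss-pascal L m = begin
    gauss (suc L) (suc m)
  ≈⟨ gauss-unfold (suc L) (suc m) ⟩
    P ⊛ oneMinusQ (suc n) ⊛ (Iₘ ⊛ gₘ) ⊛ (I_L ⊛ g_L)
  ≈⟨ ⊛-congˡ (I_L ⊛ g_L) (⊛-congˡ (Iₘ ⊛ gₘ) (⊛-congʳ P (⊖-cong (≈-refl {one}) exponent))) ⟩
    P ⊛ (one ⊖ q_L ⊛ qₘ) ⊛ (Iₘ ⊛ gₘ) ⊛ (I_L ⊛ g_L)
  ≈⟨ solve 7 (λ p i g j h a b → p :* (con 1ℤ :- a :* b) :* (i :* g) :* (j :* h)
          := (p :* i :* g :* j) :* (h :* (con 1ℤ :- a)) :+ (a :* p :* i :* j :* h) :* (g :* (con 1ℤ :- b)))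
          ≈-refl P Iₘ gₘ I_L g_L q_L qₘ ⟩
    (P ⊛ Iₘ ⊛ gₘ ⊛ I_L) ⊛ (g_L ⊛ oneMinusQ (suc L)) ⊕ (q_L ⊛ P ⊛ Iₘ ⊛ I_L ⊛ g_L) ⊛ (gₘ ⊛ oneMinusQ (suc m))
  ≈⟨ ⊕-cong (⊛-congʳ (P ⊛ Iₘ ⊛ gₘ ⊛ I_L) (geom-inverse (suc L) (s≤s z≤n)))
            (⊛-congʳ (q_L ⊛ P ⊛ Iₘ ⊛ I_L ⊛ g_L) (geom-inverse (suc m) (s≤s z≤n))) ⟩
    (P ⊛ Iₘ ⊛ gₘ ⊛ I_L) ⊛ one ⊕ (q_L ⊛ P ⊛ Iₘ ⊛ I_L ⊛ g_L) ⊛ one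
  ≈⟨ solve 7 (λ p i g j h a b → (p :* i :* g :* j) :* con 1ℤ :+ (a :* p :* i :* j :* h) :* con 1ℤ
          := p :* (i :* g) :* j :+ a :* (p :* i :* (j :* h)))
          ≈-refl P Iₘ gₘ I_L g_L q_L qₘ ⟩
    P ⊛ (Iₘ ⊛ gₘ) ⊛ I_L ⊕ q_L ⊛ (P ⊛ Iₘ ⊛ (I_L ⊛ g_L))
  ≈⟨ ⊕-cong (≈-sym (gauss-unfold L (suc m)))
            (⊛-congʳ q_L (≈-sym (≈-trans (gauss-unfold (suc L) m)
                                          (⊛-congˡ (I_L ⊛ g_L) (⊛-congˡ Iₘ (≡⇒≈ (cong (poch 1) (sym (ℕP.+-suc L m))))))))) ⟩
    gauss L (suc m) ⊕ qpow (suc L) ⊛ gauss (suc L) m ∎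
  where
    open SetoidReasoning PS-setoid
    n = L ℕ.+ suc m
    P = poch 1 n
    Iₘ = invPoch 1 m
    gₘ = geom (suc m)
    I_L = invPoch 1 L
    g_L = geom (suc L)
    q_L = qpow (suc L)
    qₘ = qpow (suc m)
    exponent : qpow (suc n) ≈ q_L ⊛ qₘ
    exponent = ≈-sym (qpow-+ (suc L) (suc m))

-- The q-binomial theorem  Σ_m q^{km} [L+m, m] = 1/(q^k; q)_{L+1}  (k ≥ 1).
-- Writing F_L for the left side, the Pascal recurrence gives
-- F_{L+1} = F_L + q^{k+L+1} F_{L+1}, i.e. F_{L+1} = F_L/(1 - q^{k+L+1}),
-- and F_0 = Σ_m q^{km} = 1/(1 - q^k).

binomialTerm : ℕ → ℕ → ℕ → PS
binomialTerm k L m = qpow (k ℕ.* m) ⊛ gauss L m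

binomialTerm-finite : ∀ k L → 1 ≤ k → LocallyFinite (binomialTerm k L)
binomialTerm-finite k L 1≤k m = vanishes-qpow m (k ℕ.* m) (gauss L m) (≤-multiple m 1≤k)

binomialTerm-0 : ∀ k L → binomialTerm k L 0 ≈ one
binomialTerm-0 k L = ≈-trans (⊛-cong (≈-trans (≡⇒≈ (cong qpow (ℕP.*-zeroʳ k))) qpow-zero) (gauss-m0 L))
                             (⊛-identityˡ one)

binomialTerm-pascal : ∀ k L m →
  binomialTerm k (suc L) (suc m) ≈ binomialTerm k L (suc m) ⊕ qpow (k ℕ.+ suc L) ⊛ binomialTerm k (suc L) m
binomialTerm-pascal k L m = begin
    qpow (k ℕ.* suc m) ⊛ gauss (suc L) (suc m)
  ≈⟨ ⊛-cong (≈-trans (≡⇒≈ (cong qpow (ℕP.*-suc k m))) (≈-sym (qpow-+ k (k ℕ.* m)))) (gauss-pascal L m) ⟩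
    (qpow k ⊛ qpow (k ℕ.* m)) ⊛ (gauss L (suc m) ⊕ qpow (suc L) ⊛ gauss (suc L) m)
  ≈⟨ solve 5 (λ a b x c d → (a :* b) :* (x :+ c :* d) := (a :* b) :* x :+ (a :* c) :* (b :* d)) ≈-refl
       (qpow k) (qpow (k ℕ.* m)) (gauss L (suc m)) (qpow (suc L)) (gauss (suc L) m) ⟩
    (qpow k ⊛ qpow (k ℕ.* m)) ⊛ gauss L (suc m) ⊕ (qpow k ⊛ qpow (suc L)) ⊛ binomialTerm k (suc L) m
  ≈⟨ ⊕-cong (⊛-congˡ (gauss L (suc m)) (≈-trans (qpow-+ k (k ℕ.* m)) (≡⇒≈ (cong qpow (sym (ℕP.*-suc k m))))))
            (⊛-congˡ (binomialTerm k (suc L) m) (qpow-+ k (suc L))) ⟩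
    binomialTerm k L (suc m) ⊕ qpow (k ℕ.+ suc L) ⊛ binomialTerm k (suc L) m ∎
  where open SetoidReasoning PS-setoid

q-binomial : ∀ k L → 1 ≤ k → Σ∞ (binomialTerm k L) ≈ invPoch k (suc L)
q-binomial k zero 1≤k = begin
    Σ∞ (binomialTerm k 0)
  ≈⟨ Σ∞-cong (λ m → ≈-trans (⊛-congʳ (qpow (k ℕ.* m)) (gauss-0m m)) (⊛-identityʳ _)) ⟩
    Σ∞ (λ m → qpow (k ℕ.* m))
  ≈⟨ geom-as-Σ∞ k 1≤k ⟩
    geom k
  ≈⟨ ≈-sym (⊛-identityˡ (geom k)) ⟩
    one ⊛ geom k
  ≈⟨ ⊛-congʳ one (≡⇒≈ (cong geom (sym (ℕP.+-identityʳ k)))) ⟩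
    invPoch k 1 ∎
  where open SetoidReasoning PS-setoid
q-binomial k (suc L) 1≤k = begin
    Σ∞ (binomialTerm k (suc L))
  ≈⟨ geom-solve (k ℕ.+ suc L) (ℕP.≤-trans 1≤k (ℕP.m≤m+n k (suc L))) F₁ F₀ recurrence ⟩
    Σ∞ (binomialTerm k L) ⊛ geom (k ℕ.+ suc L)
  ≈⟨ ⊛-congˡ (geom (k ℕ.+ suc L)) (q-binomial k L 1≤k) ⟩
    invPoch k (suc (suc L)) ∎
  where
    open SetoidReasoning PS-setoid
    F₀ = Σ∞ (binomialTerm k L)
    F₁ = Σ∞ (binomialTerm k (suc L))
    q′ = qpow (k ℕ.+ suc L)
    recurrence : F₁ ≈ F₀ ⊕ q′ ⊛ F₁
    recurrence = begin
        F₁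
      ≈⟨ Σ∞-peel _ (binomialTerm-finite k (suc L) 1≤k) ⟩
        binomialTerm k (suc L) 0 ⊕ Σ∞ (binomialTerm k (suc L) ∘ suc)
      ≈⟨ ⊕-cong (binomialTerm-0 k (suc L)) (≈-trans (Σ∞-cong (binomialTerm-pascal k L)) (Σ∞-⊕ _ _)) ⟩
        one ⊕ (Σ∞ (binomialTerm k L ∘ suc) ⊕ Σ∞ (λ m → q′ ⊛ binomialTerm k (suc L) m))
      ≈⟨ ⊕-cong (≈-refl {one}) (⊕-cong (≈-refl {Σ∞ (binomialTerm k L ∘ suc)})
                                       (≈-sym (Σ∞-⊛ˡ q′ _ (binomialTerm-finite k (suc L) 1≤k)))) ⟩
        one ⊕ (Σ∞ (binomialTerm k L ∘ suc) ⊕ q′ ⊛ F₁)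
      ≈⟨ solve 3 (λ a b c → a :+ (b :+ c) := (a :+ b) :+ c) ≈-refl one (Σ∞ (binomialTerm k L ∘ suc)) (q′ ⊛ F₁) ⟩
        (one ⊕ Σ∞ (binomialTerm k L ∘ suc)) ⊕ q′ ⊛ F₁
      ≈⟨ ⊕-cong (≈-sym (≈-trans (Σ∞-peel _ (binomialTerm-finite k L 1≤k))
                                (⊕-cong (binomialTerm-0 k L) (≈-refl {Σ∞ (binomialTerm k L ∘ suc)}))))
                (≈-refl {q′ ⊛ F₁}) ⟩
        F₀ ⊕ q′ ⊛ F₁ ∎

cancel-geom : ∀ i → 1 ≤ i → ∀ f → f ⊛ geom i ⊛ oneMinusQ i ≈ f
cancel-geom i 1≤i f = ≈-trans (⊛-assoc f (geom i) (oneMinusQ i))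
                              (≈-trans (⊛-congʳ f (geom-inverse i 1≤i)) (⊛-identityʳ f))

-- q^k/(q^k; q)_{L+1}: partitions with smallest part k and largest part at most k + L.
smallestPart : ℕ → ℕ → PS
smallestPart k L = qpow k ⊛ invPoch k (suc L)

-- Telescoping:  (1 - q^L) q^k/(q^k; q)_{L+1} = 1/(q^k; q)_L - 1/(q^{k+1}; q)_L,
-- since with X = 1/(q^k; q)_{L+1} the right side is X (1 - q^{k+L}) - X (1 - q^k).
smallestPart-telescope : ∀ k L → 1 ≤ k →
  smallestPart k L ⊛ oneMinusQ L ≈ invPoch k L ⊖ invPoch (suc k) L
smallestPart-telescope k L 1≤k = ≈-sym (begin
    invPoch k L ⊖ invPoch (suc k) L
  ≈⟨ ⊖-cong (≈-sym (cancel-geom (k ℕ.+ L) (ℕP.≤-trans 1≤k (ℕP.m≤m+n k L)) (invPoch k L)))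
            (≈-sym (cancel-geom k 1≤k (invPoch (suc k) L))) ⟩
    X ⊛ oneMinusQ (k ℕ.+ L) ⊖ (invPoch (suc k) L ⊛ geom k) ⊛ oneMinusQ k
  ≈⟨ ⊖-cong (⊛-congʳ X (⊖-cong (≈-refl {one}) (≈-sym (qpow-+ k L))))
            (⊛-congˡ (oneMinusQ k) (≈-trans (⊛-comm (invPoch (suc k) L) (geom k)) (≈-sym (invPoch-peel k L)))) ⟩
    X ⊛ (one ⊖ qpow k ⊛ qpow L) ⊖ X ⊛ (one ⊖ qpow k)
  ≈⟨ solve 3 (λ x a b → x :* (con 1ℤ :- a :* b) :- x :* (con 1ℤ :- a) := a :* x :* (con 1ℤ :- b))
       ≈-refl X (qpow k) (qpow L) ⟩
    smallestPart k L ⊛ oneMinusQ L ∎)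
  where
    open SetoidReasoning PS-setoid
    X = invPoch k (suc L)

smallestPartAtLeast2 : ℕ → PS
smallestPartAtLeast2 L = Σ∞ (λ j → smallestPart (2 ℕ.+ j) L)

smallestPartAtLeast2-finite : ∀ L → LocallyFinite (λ j → smallestPart (2 ℕ.+ j) L)
smallestPartAtLeast2-finite L j = vanishes-qpow j (2 ℕ.+ j) (invPoch (2 ℕ.+ j) (suc L)) (ℕP.m≤n+m j 2)

-- Summing the telescope:  (1 - q^L) Σ_{k≥2} q^k/(q^k; q)_{L+1} = 1/(q^2; q)_L - 1,
-- the tail 1/(q^{N+3}; q)_L being ≡ 1 modulo q^{N+1}.
smallestPartAtLeast2-telescope : ∀ L → smallestPartAtLeast2 L ⊛ oneMinusQ L ≈ invPoch 2 L ⊖ one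
smallestPartAtLeast2-telescope L = begin
    smallestPartAtLeast2 L ⊛ oneMinusQ L
  ≈⟨ Σ∞-⊛ʳ _ (oneMinusQ L) (smallestPartAtLeast2-finite L) ⟩
    Σ∞ (λ j → smallestPart (2 ℕ.+ j) L ⊛ oneMinusQ L)
  ≈⟨ Σ∞-cong (λ j → smallestPart-telescope (2 ℕ.+ j) L (s≤s z≤n)) ⟩
    Σ∞ (λ j → B j ⊖ B (suc j))
  ≈⟨ (λ N → trans (Σ∞-telescope B N) (cong (λ x → B 0 N - x) (invPoch-one-below (3 ℕ.+ N) L N (ℕP.m≤n+m (suc N) 2)))) ⟩
    invPoch 2 L ⊖ one ∎
  where
    open SetoidReasoning PS-setoid
    B : ℕ → PS
    B j = invPoch (2 ℕ.+ j) L

smallestPart1-times : ∀ L →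
  smallestPart 1 (suc L) ⊛ oneMinusQ (suc L) ≈ qpow 1 ⊛ invPoch 1 L ⊛ geom (suc (suc L))
smallestPart1-times L = begin
    qpow 1 ⊛ (invPoch 1 L ⊛ g ⊛ g′) ⊛ oneMinusQ (suc L)
  ≈⟨ solve 5 (λ a i b c u → a :* (i :* b :* c) :* u := a :* i :* c :* b :* u) ≈-refl
       (qpow 1) (invPoch 1 L) g g′ (oneMinusQ (suc L)) ⟩
    qpow 1 ⊛ invPoch 1 L ⊛ g′ ⊛ g ⊛ oneMinusQ (suc L)
  ≈⟨ cancel-geom (suc L) (s≤s z≤n) (qpow 1 ⊛ invPoch 1 L ⊛ g′) ⟩
    qpow 1 ⊛ invPoch 1 L ⊛ g′ ∎
  where
    open SetoidReasoning PS-setoid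
    g = geom (suc L)
    g′ = geom (suc (suc L))

-- The sum in G as a double sum: expanding 1/(1 - q^{m+1}) as Σ_j q^{(m+1) j}, the
-- (m+1)-st term of G is the m-th row of the array  q^{(j+2)(m+1)} [L+m, m],
-- while by the q-binomial theorem its j-th column is  q^{j+2}/(q^{j+2}; q)_{L+1}.

doubleTerm : ℕ → ℕ → ℕ → PS
doubleTerm L m j = qpow ((2 ℕ.+ j) ℕ.* suc m) ⊛ gauss L m

Gterm-as-row : ∀ L m → Gterm L (suc m) ≈ Σ∞ (doubleTerm L m)
Gterm-as-row L m = begin
    qpow (2 ℕ.* suc m) ⊛ geom (suc m) ⊛ qbinom (L ℕ.+ suc m ∸ 1) m
  ≈⟨ ⊛-cong (⊛-congʳ (qpow (2 ℕ.* suc m)) (≈-sym (geom-as-Σ∞ (suc m) (s≤s z≤n))))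
            (≡⇒≈ (cong (λ l → qbinom (l ∸ 1) m) (ℕP.+-suc L m))) ⟩
    qpow (2 ℕ.* suc m) ⊛ Σ∞ (λ j → qpow (suc m ℕ.* j)) ⊛ gauss L m
  ≈⟨ ⊛-congˡ (gauss L m) (Σ∞-⊛ˡ (qpow (2 ℕ.* suc m)) _ (qpow-multiples-finite (suc m) (s≤s z≤n))) ⟩
    Σ∞ (λ j → qpow (2 ℕ.* suc m) ⊛ qpow (suc m ℕ.* j)) ⊛ gauss L m
  ≈⟨ ⊛-congˡ (gauss L m) (Σ∞-cong (λ j → ≈-trans (qpow-+ (2 ℕ.* suc m) (suc m ℕ.* j))
                                                   (≡⇒≈ (cong qpow (exponent m j))))) ⟩
    Σ∞ (λ j → qpow ((2 ℕ.+ j) ℕ.* suc m)) ⊛ gauss L m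
  ≈⟨ Σ∞-⊛ʳ _ (gauss L m) (qpow-family-finite (λ j → (2 ℕ.+ j) ℕ.* suc m) (λ j → below m j)) ⟩
    Σ∞ (doubleTerm L m) ∎
  where
    open SetoidReasoning PS-setoid
    exponent : ∀ m j → 2 ℕ.* suc m ℕ.+ suc m ℕ.* j ≡ (2 ℕ.+ j) ℕ.* suc m
    exponent = ℕ-Solver.solve-∀
    below : ∀ m j → j ≤ (2 ℕ.+ j) ℕ.* suc m
    below m j = ℕP.≤-trans (ℕP.m≤n+m j 2) (ℕP.m≤m*n (2 ℕ.+ j) (suc m))

smallestPart-as-column : ∀ L j → smallestPart (2 ℕ.+ j) L ≈ Σ∞ (λ m → doubleTerm L m j)
smallestPart-as-column L j = begin
    qpow k ⊛ invPoch k (suc L)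
  ≈⟨ ⊛-congʳ (qpow k) (≈-sym (q-binomial k L (s≤s z≤n))) ⟩
    qpow k ⊛ Σ∞ (binomialTerm k L)
  ≈⟨ Σ∞-⊛ˡ (qpow k) (binomialTerm k L) (binomialTerm-finite k L (s≤s z≤n)) ⟩
    Σ∞ (λ m → qpow k ⊛ (qpow (k ℕ.* m) ⊛ gauss L m))
  ≈⟨ Σ∞-cong (λ m → ≈-trans (≈-sym (⊛-assoc (qpow k) (qpow (k ℕ.* m)) (gauss L m)))
                            (⊛-congˡ (gauss L m) (≈-trans (qpow-+ k (k ℕ.* m)) (≡⇒≈ (cong qpow (exponent m)))))) ⟩
    Σ∞ (λ m → doubleTerm L m j) ∎
  where
    open SetoidReasoning PS-setoid
    k = 2 ℕ.+ j
    exponent : ∀ m → k ℕ.+ k ℕ.* m ≡ k ℕ.* suc m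
    exponent m = sym (ℕP.*-suc k m)

Gsum-as-smallestParts : ∀ L → Σ∞ (Gterm L ∘ suc) ≈ smallestPartAtLeast2 L
Gsum-as-smallestParts L = begin
    Σ∞ (Gterm L ∘ suc)
  ≈⟨ Σ∞-cong (Gterm-as-row L) ⟩
    Σ∞ (λ m → Σ∞ (doubleTerm L m))
  ≈⟨ Σ∞-swap (doubleTerm L) ⟩
    Σ∞ (λ j → Σ∞ (λ m → doubleTerm L m j))
  ≈⟨ Σ∞-cong (λ j → ≈-sym (smallestPart-as-column L j)) ⟩
    smallestPartAtLeast2 L ∎
  where open SetoidReasoning PS-setoid

-- Combinatorial form of G: (smallest part 1) minus (smallest part ≥ 2).
-- The defining sum of G stops at n = N for the coefficient of q^N, because
-- the term n = N + 1 is O(q^{2N+2}).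
G-as-difference : ∀ L → G L ≈ smallestPart 1 L ⊖ smallestPartAtLeast2 L
G-as-difference L N = cong (λ s → smallestPart 1 L N - s)
  (trans (sym (trans (cong (sumBelow N (λ j → Gterm L (suc j) N) +_) last-vanishes) (ℤP.+-identityʳ _)))
         (Gsum-as-smallestParts L N))
  where
    last-vanishes : Gterm L (suc N) N ≡ 0ℤ
    last-vanishes = vanishes-⊛ˡ (2 ℕ.* suc N) _ (qbinom (L ℕ.+ suc N ∸ 1) N)
      (vanishes-qpow (2 ℕ.* suc N) (2 ℕ.* suc N) (geom (suc N)) ℕP.≤-refl) N (ℕP.m≤m+n (suc N) (suc N ℕ.+ 0))

G-identity : ∀ L → G (suc L) ≈ H (suc L) ⊛ geom (suc L)
G-identity L = begin
    G L′
  ≈⟨ ≈-sym (cancel-geom L′ (s≤s z≤n) (G L′)) ⟩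
    G L′ ⊛ g ⊛ oneMinusQ L′
  ≈⟨ solve 3 (λ x g u → x :* g :* u := (x :* u) :* g) ≈-refl (G L′) g (oneMinusQ L′) ⟩
    (G L′ ⊛ oneMinusQ L′) ⊛ g
  ≈⟨ ⊛-congˡ g (⊛-congˡ (oneMinusQ L′) (G-as-difference L′)) ⟩
    ((smallestPart 1 L′ ⊖ smallestPartAtLeast2 L′) ⊛ oneMinusQ L′) ⊛ g
  ≈⟨ ⊛-congˡ g (solve 3 (λ a s u → (a :- s) :* u := a :* u :- s :* u) ≈-refl
                   (smallestPart 1 L′) (smallestPartAtLeast2 L′) (oneMinusQ L′)) ⟩
    (smallestPart 1 L′ ⊛ oneMinusQ L′ ⊖ smallestPartAtLeast2 L′ ⊛ oneMinusQ L′) ⊛ g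
  ≈⟨ ⊛-congˡ g (⊖-cong (smallestPart1-times L) (smallestPartAtLeast2-telescope L′)) ⟩
    H L′ ⊛ g ∎
  where
    open SetoidReasoning PS-setoid
    L′ = suc L
    g = geom L′

NonNeg : PS → Set
NonNeg f = ∀ n → 0ℤ ≤ℤ f n

nonNeg-cong : ∀ {f g} → f ≈ g → NonNeg f → NonNeg g
nonNeg-cong f≈g f≥0 n = subst (0ℤ ≤ℤ_) (f≈g n) (f≥0 n)

nonNeg-⊕ : ∀ {f g} → NonNeg f → NonNeg g → NonNeg (f ⊕ g)
nonNeg-⊕ f≥0 g≥0 n = ℤP.+-mono-≤ (f≥0 n) (g≥0 n)

nonNeg-⊛ : ∀ {f g} → NonNeg f → NonNeg g → NonNeg (f ⊛ g)
nonNeg-⊛ {f} {g} f≥0 g≥0 n = sum-nonNeg (suc n) _ (λ k → product (f≥0 k) (g≥0 (n ∸ k)))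
  where
    product : ∀ {a b} → 0ℤ ≤ℤ a → 0ℤ ≤ℤ b → 0ℤ ≤ℤ a * b
    product {ℤ.+ a} {ℤ.+ b} _ _ = subst (0ℤ ≤ℤ_) (ℤP.pos-* a b) (ℤ.+≤+ z≤n)
    sum-nonNeg : ∀ m (h : ℕ → ℤ) → (∀ k → 0ℤ ≤ℤ h k) → 0ℤ ≤ℤ sumBelow m h
    sum-nonNeg zero    h h≥0 = ℤP.≤-refl
    sum-nonNeg (suc m) h h≥0 = ℤP.+-mono-≤ (sum-nonNeg m h h≥0) (h≥0 m)

decided-nonNeg : ∀ {P : Set} (d : Dec P) → 0ℤ ≤ℤ (if does d then 1ℤ else 0ℤ)
decided-nonNeg (yes _) = ℤ.+≤+ z≤n
decided-nonNeg (no _)  = ℤ.+≤+ z≤n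

decided-≤1 : ∀ {P : Set} (d : Dec P) → (if does d then 1ℤ else 0ℤ) ≤ℤ 1ℤ
decided-≤1 (yes _) = ℤP.≤-refl
decided-≤1 (no _)  = ℤ.+≤+ z≤n

nonNeg-qpow : ∀ i → NonNeg (qpow i)
nonNeg-qpow i n = decided-nonNeg (i ℕ.≟ n)

nonNeg-geom : ∀ i → NonNeg (geom i)
nonNeg-geom i n = decided-nonNeg (i ∣? n)

-- For a product P of factors 1/(1 - q^t) and T the sum of the corresponding
-- monomials q^t:  1 ≤ P  and  P - 1 ≤ T P  coefficientwise.  Indeed, adding a
-- factor 1/(1 - q^t) = 1 + q^t/(1 - q^t) gives
--   P/(1 - q^t) - 1 = (P - 1)/(1 - q^t) + q^t/(1 - q^t)
--                   ≤ T P/(1 - q^t) + q^t P/(1 - q^t).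
ProductBound : PS → PS → Set
ProductBound P T = NonNeg (P ⊖ one) × NonNeg (T ⊛ P ⊖ (P ⊖ one))

productBound-step : ∀ P T t → 1 ≤ t → ProductBound P T → ProductBound (P ⊛ geom t) (T ⊕ qpow t)
productBound-step P T t 1≤t (P≥1 , P-1≤TP) =
    nonNeg-cong (≈-sym new-excess) (nonNeg-⊕ (nonNeg-⊛ P≥1 (nonNeg-geom t)) (nonNeg-⊛ (nonNeg-qpow t) (nonNeg-geom t)))
  , nonNeg-cong (≈-sym new-slack) (nonNeg-⊕ (nonNeg-⊛ P-1≤TP (nonNeg-geom t))
                                            (nonNeg-⊛ (nonNeg-⊛ (nonNeg-qpow t) (nonNeg-geom t)) P≥1))
  where
    g = geom t
    q = qpow t
    g-1 : g ⊖ one ≈ q ⊛ g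
    g-1 = ≈-trans (⊖-cong (geom-unfold t 1≤t) (≈-refl {one})) (solve 1 (λ x → con 1ℤ :+ x :- con 1ℤ := x) ≈-refl (q ⊛ g))
    new-excess : P ⊛ g ⊖ one ≈ (P ⊖ one) ⊛ g ⊕ q ⊛ g
    new-excess = ≈-trans (solve 2 (λ p g → p :* g :- con 1ℤ := (p :- con 1ℤ) :* g :+ (g :- con 1ℤ)) ≈-refl P g)
                         (⊕-cong (≈-refl {(P ⊖ one) ⊛ g}) g-1)
    new-slack : (T ⊕ q) ⊛ (P ⊛ g) ⊖ (P ⊛ g ⊖ one) ≈ (T ⊛ P ⊖ (P ⊖ one)) ⊛ g ⊕ (q ⊛ g) ⊛ (P ⊖ one)
    new-slack = ≈-trans (solve 4 (λ t q p g → (t :+ q) :* (p :* g) :- (p :* g :- con 1ℤ)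
                                   := (t :* p :- (p :- con 1ℤ)) :* g :+ (q :* p :* g :- (g :- con 1ℤ))) ≈-refl T q P g)
                (⊕-cong (≈-refl {(T ⊛ P ⊖ (P ⊖ one)) ⊛ g})
                        (≈-trans (⊖-cong (≈-refl {q ⊛ P ⊛ g}) g-1)
                                 (solve 3 (λ q p g → q :* p :* g :- q :* g := (q :* g) :* (p :- con 1ℤ)) ≈-refl q P g)))

monomialSum : ℕ → ℕ → PS
monomialSum e zero    = zeroPS
monomialSum e (suc m) = monomialSum e m ⊕ qpow (e ℕ.+ m)

invPoch-bound : ∀ e m → 1 ≤ e → ProductBound (invPoch e m) (monomialSum e m)
invPoch-bound e zero    _   = (λ { zero → ℤ.+≤+ z≤n ; (suc n) → ℤ.+≤+ z≤n })
                            , (λ n → subst (0ℤ ≤ℤ_) (sym (cong₂ _-_ (sum-zero (suc n) (λ _ _ → refl))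
                                                                   (ℤP.+-inverseʳ (one n)))) (ℤ.+≤+ z≤n))
invPoch-bound e (suc m) 1≤e = productBound-step (invPoch e m) (monomialSum e m) (e ℕ.+ m)
                                (ℕP.≤-trans 1≤e (ℕP.m≤m+n e m)) (invPoch-bound e m 1≤e)

monomialSum-outside : ∀ e m n → n < e ⊎ e ℕ.+ m ≤ n → monomialSum e m n ≡ 0ℤ
monomialSum-outside e zero    n _ = refl
monomialSum-outside e (suc m) n (inj₁ n<e) =
  cong₂ _+_ (monomialSum-outside e m n (inj₁ n<e))
            (decide-no (e ℕ.+ m ℕ.≟ n) (λ e+m≡n → ℕP.<⇒≱ n<e (subst (e ≤_) e+m≡n (ℕP.m≤m+n e m))))
monomialSum-outside e (suc m) n (inj₂ e+m+1≤n) =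
  cong₂ _+_ (monomialSum-outside e m n (inj₂ (ℕP.≤-trans (ℕP.+-monoʳ-≤ e (ℕP.n≤1+n m)) e+m+1≤n)))
            (decide-no (e ℕ.+ m ℕ.≟ n) (λ e+m≡n → ℕP.<⇒≱ (subst (_< e ℕ.+ suc m) e+m≡n (ℕP.+-monoʳ-< e ℕP.≤-refl)) e+m+1≤n))

monomialSum-inside : ∀ e m n → e ≤ n → n < e ℕ.+ m → monomialSum e m n ≡ 1ℤ
monomialSum-inside e zero    n e≤n n<e+0 = ⊥-elim (ℕP.<⇒≱ n<e+0 (subst (_≤ n) (sym (ℕP.+-identityʳ e)) e≤n))
monomialSum-inside e (suc m) n e≤n n<e+m+1 with e ℕ.+ m ℕ.≟ n
... | yes refl = cong₂ _+_ (monomialSum-outside e m (e ℕ.+ m) (inj₂ ℕP.≤-refl)) (decide-yes (e ℕ.+ m ℕ.≟ e ℕ.+ m) refl)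
... | no  e+m≢n = cong₂ _+_ (monomialSum-inside e m n e≤n n<e+m) (decide-no (e ℕ.+ m ℕ.≟ n) e+m≢n)
  where n<e+m = ℕP.≤∧≢⇒< (ℕP.≤-pred (subst (n <_) (ℕP.+-suc e m) n<e+m+1)) (e+m≢n ∘ sym)

H1-quotient : H 1 ⊛ geom 1 ≈ qpow 1 ⊛ geom 2
H1-quotient = begin
    (q ⊛ one ⊛ g₂ ⊖ (one ⊛ g₂ ⊖ one)) ⊛ g₁
  ≈⟨ ⊛-congˡ g₁ (⊖-cong (⊛-congˡ g₂ (⊛-identityʳ q)) (⊖-cong (⊛-identityˡ g₂) (≈-refl {one}))) ⟩
    (q ⊛ g₂ ⊖ (g₂ ⊖ one)) ⊛ g₁
  ≈⟨ ⊛-congˡ g₁ (⊖-cong (≈-refl {q ⊛ g₂}) (⊖-cong (geom-unfold 2 (s≤s z≤n)) (≈-refl {one}))) ⟩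
    (q ⊛ g₂ ⊖ (one ⊕ qpow 2 ⊛ g₂ ⊖ one)) ⊛ g₁
  ≈⟨ ⊛-congˡ g₁ (⊖-cong (≈-refl {q ⊛ g₂}) (⊖-cong (⊕-cong (≈-refl {one}) (⊛-congˡ g₂ (≈-sym (qpow-+ 1 1)))) (≈-refl {one}))) ⟩
    (q ⊛ g₂ ⊖ (one ⊕ q ⊛ q ⊛ g₂ ⊖ one)) ⊛ g₁
  ≈⟨ solve 3 (λ q g h → (q :* g :- (con 1ℤ :+ q :* q :* g :- con 1ℤ)) :* h := q :* g :* h :* (con 1ℤ :- q)) ≈-refl q g₂ g₁ ⟩
    q ⊛ g₂ ⊛ g₁ ⊛ oneMinusQ 1
  ≈⟨ cancel-geom 1 ℕP.≤-refl (q ⊛ g₂) ⟩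
    q ⊛ g₂ ∎
  where
    open SetoidReasoning PS-setoid
    q = qpow 1
    g₁ = geom 1
    g₂ = geom 2

H1-nonNeg : NonNeg (H 1 ⊛ geom 1)
H1-nonNeg = nonNeg-cong (≈-sym H1-quotient) (nonNeg-⊛ (nonNeg-qpow 1) (nonNeg-geom 2))

-- L = k + 2 ≥ 2.  With C = 1/((q^2; q)_{L-2} (1 - q^{L+1})), the product of the
-- factors 1/(1 - q^t) for t ∈ {2, ..., L-1, L+1}, T = Σ_t q^t and
-- R = q/(1 - q) - 1/(1 - q^L) + 1, one has  H_{L,1} = C R - (C - 1)
--   = (T C - (C - 1)) + C (R - T),
-- where both summands are non-negative: the first by the product bound for C, the second
-- since R = Σ_{n ≥ 1, L ∤ n} q^n contains every monomial of T.
module LargeL (k : ℕ) where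

  private
    L = suc (suc k)
    D = invPoch 2 k
    C = D ⊛ geom (suc L)
    T = monomialSum 2 k ⊕ qpow (suc L)
    R = qpow 1 ⊛ geom 1 ⊖ geom L ⊕ one

  H-decomposition : H L ≈ (T ⊛ C ⊖ (C ⊖ one)) ⊕ C ⊛ (R ⊖ T)
  H-decomposition = begin
      qpow 1 ⊛ invPoch 1 (suc k) ⊛ geom (suc L) ⊖ (D ⊛ geom L ⊛ geom (suc L) ⊖ one)
    ≈⟨ ⊖-cong (⊛-congˡ (geom (suc L)) (⊛-congʳ (qpow 1) (invPoch-peel 1 k)))
              (≈-refl {D ⊛ geom L ⊛ geom (suc L) ⊖ one}) ⟩
      qpow 1 ⊛ (geom 1 ⊛ D) ⊛ geom (suc L) ⊖ (D ⊛ geom L ⊛ geom (suc L) ⊖ one)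
    ≈⟨ solve 6 (λ q g d a b t → q :* (g :* d) :* b :- (d :* a :* b :- con 1ℤ)
                 := (t :* (d :* b) :- (d :* b :- con 1ℤ)) :+ (d :* b) :* ((q :* g :- a :+ con 1ℤ) :- t))
         ≈-refl (qpow 1) (geom 1) D (geom L) (geom (suc L)) T ⟩
      (T ⊛ C ⊖ (C ⊖ one)) ⊕ C ⊛ (R ⊖ T) ∎
    where open SetoidReasoning PS-setoid

  C-bound : ProductBound C T
  C-bound = productBound-step D (monomialSum 2 k) (suc L) (s≤s z≤n) (invPoch-bound 2 k (s≤s z≤n))

  C-nonNeg : NonNeg C
  C-nonNeg = nonNeg-cong (solve 1 (λ c → (c :- con 1ℤ) :+ con 1ℤ := c) ≈-refl C)
                         (nonNeg-⊕ (proj₁ C-bound) (λ { zero → ℤ.+≤+ z≤n ; (suc _) → ℤ.+≤+ z≤n }))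

  R-zero : R 0 ≡ 0ℤ
  R-zero = cong₂ (λ a b → (a - b) + 1ℤ) (qpow-below 1 (geom 1) 0 (s≤s z≤n)) (geom-small L 0 (s≤s z≤n))

  R-suc : ∀ n → R (suc n) ≡ 1ℤ - geom L (suc n)
  R-suc n = trans (cong (λ a → (a - geom L (suc n)) + 0ℤ)
                        (trans (qpow-shift 1 (geom 1) (suc n) (s≤s z≤n)) (decide-yes (1 ∣? n) (Div.1∣ n))))
                  (ℤP.+-identityʳ (1ℤ - geom L (suc n)))

  R-suc-nondivisible : ∀ n → ¬ (L ∣ suc n) → R (suc n) ≡ 1ℤ
  R-suc-nondivisible n L∤ = trans (R-suc n) (cong (λ b → 1ℤ - b) (decide-no (L ∣? suc n) L∤))

  L∤L+1 : ¬ (L ∣ suc L)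
  L∤L+1 L∣L+1 with Div.∣1⇒≡1 (Div.∣m+n∣m⇒∣n (subst (L ∣_) (ℕP.+-comm 1 L) L∣L+1) Div.∣-refl)
  ... | ()

  T-outside : ∀ n → suc n ≢ suc L → suc n < 2 ⊎ L ≤ suc n → T (suc n) ≤ℤ R (suc n)
  T-outside n n≢L out = subst₂ _≤ℤ_ (sym (cong₂ _+_ (monomialSum-outside 2 k (suc n) out)
                                                     (decide-no (suc L ℕ.≟ suc n) (n≢L ∘ sym))))
                                    (sym (R-suc n)) (ℤP.i≤j⇒0≤j-i (decided-≤1 (L ∣? suc n)))

  T≤R : ∀ n → T n ≤ℤ R n
  T≤R zero = subst₂ _≤ℤ_ (sym (cong₂ _+_ (monomialSum-outside 2 k 0 (inj₁ (s≤s z≤n))) (decide-no (suc L ℕ.≟ 0) (λ ()))))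
                         (sym R-zero) ℤP.≤-refl
  T≤R (suc n) with suc n ℕ.≟ suc L
  ... | yes refl = subst₂ _≤ℤ_ (sym (cong₂ _+_ (monomialSum-outside 2 k (suc L) (inj₂ (ℕP.n≤1+n L)))
                                                (decide-yes (suc L ℕ.≟ suc L) refl)))
                               (sym (R-suc-nondivisible L L∤L+1)) ℤP.≤-refl
  ... | no n≢L with 2 ℕ.≤? suc n | suc n ℕ.<? L
  ...   | yes 2≤n+1 | yes n+1<L = subst₂ _≤ℤ_ (sym (cong₂ _+_ (monomialSum-inside 2 k (suc n) 2≤n+1 n+1<L)
                                                             (decide-no (suc L ℕ.≟ suc n) (n≢L ∘ sym))))
                                            (sym (R-suc-nondivisible n (λ L∣ → ℕP.<⇒≱ n+1<L (Div.∣⇒≤ L∣)))) ℤP.≤-refl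
  ...   | no  2≰n+1 | _         = T-outside n n≢L (inj₁ (ℕP.≰⇒> 2≰n+1))
  ...   | yes _     | no  n+1≮L = T-outside n n≢L (inj₂ (ℕP.≮⇒≥ n+1≮L))

  H-quotient-nonNeg : NonNeg (H L ⊛ geom L)
  H-quotient-nonNeg = nonNeg-⊛ (nonNeg-cong (≈-sym H-decomposition)
                                 (nonNeg-⊕ (proj₂ C-bound) (nonNeg-⊛ C-nonNeg (λ n → ℤP.i≤j⇒0≤j-i (T≤R n)))))
                               (nonNeg-geom L)

quotient-nonNeg : ∀ L → NonNeg (H (suc L) ⊛ geom (suc L))
quotient-nonNeg zero    = H1-nonNeg
quotient-nonNeg (suc k) = LargeL.H-quotient-nonNeg k

theorem5p1 : (L : ℕ) → 1 ≤ L →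
    ((N : ℕ) → G L N ≡ (H L ⊛ geom L) N) × ((N : ℕ) → 0ℤ ≤ℤ G L N)
theorem5p1 (suc L) _ = G-identity L , nonNeg-cong (≈-sym (G-identity L)) (quotient-nonNeg L)
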